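{- In any layer $L_i$ of $A_n$ there do not exist three consecutive nonempty rows $s,s+1,s+2$ whose lengths satisfy $\ell_s=\ell_{s+1}+1$ and $\ell_{s+1}=\ell_{s+2}+1$ (i.e. lengths each increased by one going upward).
   Context: For $n\ge1$ and $A_n=(a_1,\dots,a_n)$, for each $i\le n$ divisible by neither 2 nor 3 the layer $L_i$ is $\{a_{i2^k3^s}:k,s\ge0,\ i2^k3^s\le n\}$, with $a_{i2^k3^s}$ placed in row $s$, column $k$. Row $s$ consists of the elements $a_{i3^s2^k}$ with $i3^s2^k\le n$, and $\ell_s$ denotes its number of elements. -}

module Defs where

open import Data.Nat using (ℕ; suc; _*_; _^_; _≤?_)
open import Data.List using (List; length; filter; upTo)

-- Row s of layer L_i of A_n consists of the entries a_{i 3^s 2^k} with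
-- i 3^s 2^k ≤ n (k ≥ 0).  Since 2^k > k, every such k (for i ≥ 1)
-- satisfies k ≤ n, so counting over k ∈ {0,…,n} counts all of them.
rowLength : (n i s : ℕ) → ℕ
rowLength n i s = length (filter (λ k → i * 3 ^ s * 2 ^ k ≤? n) (upTo (suc n)))

{-# OPTIONS --safe #-}
-- Put m = i 3^s.  Row s has length ℓ_s = #{k : m 2^k ≤ n}, and these k form an
-- initial segment {0,…,ℓ_s − 1}.  If ℓ_{s+2} = j + 1 ≥ 1 then 9 m 2^j ≤ n, and since
-- 2^3 < 3^2 also m 2^(j+3) ≤ n, so ℓ_s ≥ j + 4 = ℓ_{s+2} + 3.  Hence ℓ_s can never
-- equal ℓ_{s+2} + 2, which is what two unit steps ℓ_s = ℓ_{s+1} + 1 = ℓ_{s+2} + 2 need.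
module Submission where

open import Defs
open import Data.Nat using (ℕ; zero; suc; pred; _≤_; _<_; _+_; _*_; _^_; _≤?_; s≤s; z<s; >-nonZero)
open import Data.Nat.Divisibility using (_∣_)
open import Data.Nat.Properties
open import Data.Nat.Solver using (module +-*-Solver)
open import Data.List using ([_]; _∷ʳ_; _++_; length; filter; upTo)
open import Data.List.Properties using (upTo-∷ʳ; length-upTo; length-++; length-filter; filter-++; filter-accept; filter-reject; filter-all)
open import Data.List.Relation.Unary.All.Properties using (applyUpTo⁺₁)
open import Data.Product using (_×_; _,_)
open import Function using (id; _∘_)
open import Level using (Level; 0ℓ)
open import Relation.Binary.PropositionalEquality using (_≡_; refl; sym; trans; cong; subst; module ≡-Reasoning)
open import Relation.Nullary using (¬_; yes; no)
open import Relation.Unary using (Pred; Decidable)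

open +-*-Solver using (solve; _:=_; con; _:*_)

module _ {p : Level} {P : Pred ℕ p} (P? : Decidable P) where

  countUpTo : ℕ → ℕ
  countUpTo N = length (filter P? (upTo N))

  countUpTo≤ : ∀ N → countUpTo N ≤ N
  countUpTo≤ N = subst (countUpTo N ≤_) (length-upTo N) (length-filter P? (upTo N))

  countUpTo-suc : ∀ N → countUpTo (suc N) ≡ countUpTo N + length (filter P? [ N ])
  countUpTo-suc N = begin
    length (filter P? (upTo (suc N)))               ≡⟨ cong (length ∘ filter P?) (upTo-∷ʳ N) ⟨
    length (filter P? (upTo N ∷ʳ N))                ≡⟨ cong length (filter-++ P? (upTo N) [ N ]) ⟩
    length (filter P? (upTo N) ++ filter P? [ N ])  ≡⟨ length-++ (filter P? (upTo N)) ⟩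
    countUpTo N + length (filter P? [ N ])          ∎
    where open ≡-Reasoning

  countUpTo-suc-accept : ∀ {N} → P N → countUpTo (suc N) ≡ suc (countUpTo N)
  countUpTo-suc-accept {N} PN = trans (countUpTo-suc N)
    (trans (cong (λ xs → countUpTo N + length xs) (filter-accept P? PN)) (+-comm (countUpTo N) 1))

  countUpTo-suc-reject : ∀ {N} → ¬ P N → countUpTo (suc N) ≡ countUpTo N
  countUpTo-suc-reject {N} ¬PN = trans (countUpTo-suc N)
    (trans (cong (λ xs → countUpTo N + length xs) (filter-reject P? ¬PN)) (+-identityʳ (countUpTo N)))

  countUpTo-all : ∀ {N} → (∀ {k} → k < N → P k) → countUpTo N ≡ N
  countUpTo-all {N} all = trans (cong length (filter-all P? (applyUpTo⁺₁ id N all))) (length-upTo N)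

  module _ (P-downClosed : ∀ {j k} → j ≤ k → P k → P j) where

    <countUpTo⇒P : ∀ N {k} → k < countUpTo N → P k
    <countUpTo⇒P (suc N) {k} k<c with P? N
    ... | yes PN = P-downClosed (≤-trans (≤-pred (subst (k <_) (countUpTo-suc-accept PN) k<c)) (countUpTo≤ N)) PN
    ... | no ¬PN = <countUpTo⇒P N (subst (k <_) (countUpTo-suc-reject ¬PN) k<c)

    P⇒<countUpTo : ∀ N {k} → P k → k < N → k < countUpTo N
    P⇒<countUpTo (suc N) {k} Pk k<1+N with P? N
    ... | yes PN = subst (k <_) (sym (countUpTo-suc-accept PN))
                     (s≤s (subst (k ≤_) (sym (countUpTo-all (λ k<N → P-downClosed (<⇒≤ k<N) PN))) (≤-pred k<1+N)))
    ... | no ¬PN = subst (k <_) (sym (countUpTo-suc-reject ¬PN))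
                     (P⇒<countUpTo N Pk (≤∧≢⇒< (≤-pred k<1+N) λ { refl → ¬PN Pk }))

n<2^n : ∀ n → n < 2 ^ n
n<2^n zero    = z<s
n<2^n (suc n) = +-mono-≤ (m^n>0 2 n) (subst (suc n ≤_) (sym (+-identityʳ (2 ^ n))) (n<2^n n))

Fits : ℕ → ℕ → Pred ℕ 0ℓ
Fits m n k = m * 2 ^ k ≤ n

fits? : ∀ m n → Decidable (Fits m n)
fits? m n k = m * 2 ^ k ≤? n

fits-downClosed : ∀ m n {j k} → j ≤ k → Fits m n k → Fits m n j
fits-downClosed m n j≤k = ≤-trans (*-monoʳ-≤ m (^-monoʳ-≤ 2 j≤k))

fits⇒< : ∀ {m n k} → 1 ≤ m → Fits m n k → k < n
fits⇒< {m} {n} {k} 1≤m fits = begin-strict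
  k          <⟨ n<2^n k ⟩
  2 ^ k      ≡⟨ *-identityˡ (2 ^ k) ⟨
  1 * 2 ^ k  ≤⟨ *-monoˡ-≤ (2 ^ k) 1≤m ⟩
  m * 2 ^ k  ≤⟨ fits ⟩
  n          ∎
  where open ≤-Reasoning

fits-3²⇒fits-2³ : ∀ i s n j → Fits (i * 3 ^ (2 + s)) n j → Fits (i * 3 ^ s) n (3 + j)
fits-3²⇒fits-2³ i s n j fits = begin
  i * 3 ^ s * 2 ^ (3 + j)   ≡⟨ solve 3 (λ i a b → i :* a :* (con 2 :* (con 2 :* (con 2 :* b)))
                                                := con 8 :* (i :* a :* b)) refl i (3 ^ s) (2 ^ j) ⟩
  8 * (i * 3 ^ s * 2 ^ j)   ≤⟨ *-monoˡ-≤ (i * 3 ^ s * 2 ^ j) (n≤1+n 8) ⟩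
  9 * (i * 3 ^ s * 2 ^ j)   ≡⟨ solve 3 (λ i a b → con 9 :* (i :* a :* b)
                                                := i :* (con 3 :* (con 3 :* a)) :* b) refl i (3 ^ s) (2 ^ j) ⟩
  i * 3 ^ (2 + s) * 2 ^ j   ≤⟨ fits ⟩
  n                         ∎
  where open ≤-Reasoning

rowLength-gap : ∀ n i s → 1 ≤ i → 1 ≤ rowLength n i (2 + s) → 3 + rowLength n i (2 + s) ≤ rowLength n i s
rowLength-gap n i s 1≤i 1≤ℓ₂ = subst (λ ℓ → 3 + ℓ ≤ rowLength n i s) 1+j≡ℓ₂
  (P⇒<countUpTo (fits? (i * 3 ^ s) n) (fits-downClosed (i * 3 ^ s) n) (suc n)
    fits-3+j (s≤s (<⇒≤ (fits⇒< 1≤m fits-3+j))))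
  where
  ℓ₂ = rowLength n i (2 + s)
  j = pred ℓ₂
  1+j≡ℓ₂ : suc j ≡ ℓ₂
  1+j≡ℓ₂ = suc-pred ℓ₂ {{>-nonZero 1≤ℓ₂}}
  1≤m : 1 ≤ i * 3 ^ s
  1≤m = *-mono-≤ 1≤i (m^n>0 3 s)
  fits-3+j : Fits (i * 3 ^ s) n (3 + j)
  fits-3+j = fits-3²⇒fits-2³ i s n j
    (<countUpTo⇒P (fits? (i * 3 ^ (2 + s)) n) (fits-downClosed (i * 3 ^ (2 + s)) n) (suc n) (≤-reflexive 1+j≡ℓ₂))

lemmaA2 : (n i s : ℕ) → 1 ≤ n → 1 ≤ i → i ≤ n → ¬ (2 ∣ i) → ¬ (3 ∣ i) →
    1 ≤ rowLength n i s → 1 ≤ rowLength n i (suc s) → 1 ≤ rowLength n i (suc (suc s)) →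
    ¬ ((rowLength n i s ≡ rowLength n i (suc s) + 1) × (rowLength n i (suc s) ≡ rowLength n i (suc (suc s)) + 1))
lemmaA2 n i s _ 1≤i _ _ _ _ _ 1≤ℓ₂ (ℓ₀≡ℓ₁+1 , ℓ₁≡ℓ₂+1) = 1+n≰n (begin
  3 + ℓ₂      ≤⟨ rowLength-gap n i s 1≤i 1≤ℓ₂ ⟩
  ℓ₀          ≡⟨ ℓ₀≡ℓ₁+1 ⟩
  ℓ₁ + 1      ≡⟨ cong (_+ 1) ℓ₁≡ℓ₂+1 ⟩
  ℓ₂ + 1 + 1  ≡⟨ trans (+-assoc ℓ₂ 1 1) (+-comm ℓ₂ 2) ⟩
  2 + ℓ₂      ∎)
  where
  open ≤-Reasoning
  ℓ₀ = rowLength n i s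
  ℓ₁ = rowLength n i (suc s)
  ℓ₂ = rowLength n i (suc (suc s))
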